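{- Let $\Gamma$ be an oriented Feynman graph which is cycle-free, and regard its vertex set $\mathcal V(\Gamma)$ as a poset, where $v<w$ iff there is a directed path from $v$ to $w$. Let $\gamma$ be a covering subgraph of $\Gamma$ and let $\mathcal V(\Gamma)=P_1\sqcup\cdots\sqcup P_n$ be the associated partition of the vertex set. If the contracted graph $\Gamma/\gamma$ is cycle-free, then each $P_j$ ($j\in\{1,\ldots,n\}$) is a convex subset of the poset $\mathcal V(\Gamma)$, i.e. whenever $v,w\in P_j$ and $u\in\mathcal V(\Gamma)$ satisfy $v<u<w$, then $u\in P_j$.
   Context: An oriented Feynman graph is an oriented (non-planar) graph with finitely many vertices and edges; edges are internal (both ends attached to vertices, possibly the same vertex for a self-loop) or external (one end attached to a vertex, the other end open). Edges may carry types (positive integers). A cycle is a finite collection $(e_1,\ldots,e_n)$ of oriented internal edges such that the target of $e_k$ is the source of $e_{k+1}$ for all $k$ modulo $n$; a graph is cycle-free if it has no cycle (in particular no self-loop). For a cycle-free graph, $v<w$ on vertices means there is a directed path $(e_1,\ldots,e_n)$ of edges with $v$ the source of $e_1$, $w$ the target of $e_n$, and the target of $e_k$ equal to the source of $e_{k+1}$; this is a (strict) partial order. For a nonempty subset $P\subseteq\mathcal V(\Gamma)$, the subgraph $\Gamma(P)$ has as internal edges the internal edges of $\Gamma$ with both ends in $P$, and as external edges the external edges of $\Gamma$ attached to a vertex of $P$ together with the internal edges of $\Gamma$ having exactly one end in $P$ (orientations inherited); $\Gamma(P)$ is connected iff any two vertices of $P$ are joined by a path of internal edges of $\Gamma$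 with both ends in $P$, traversed forwards or backwards. A covering subgraph of $\Gamma$ is a collection $\gamma=\{\Gamma(P_1),\ldots,\Gamma(P_n)\}$ of connected subgraphs with $P_1,\ldots,P_n$ pairwise disjoint and covering $\mathcal V(\Gamma)$; equivalently a partition of $\mathcal V(\Gamma)$ into subsets $P_j$ with each $\Gamma(P_j)$ connected. The contracted graph $\Gamma/\gamma$ is obtained from $\Gamma$ by shrinking each connected component $\Gamma(P_j)$ of $\gamma$ to a single vertex: its vertices are the blocks $P_j$, its internal edges are the internal edges of $\Gamma$ joining vertices in different blocks (with the induced orientation), and its external edges are those of $\Gamma$. -}

module Defs where

open import Data.Nat using (ℕ; NonZero)
open import Data.Fin using (Fin)
open import Data.Product using (Σ; ∃; _×_; _,_)
open import Relation.Binary.PropositionalEquality using (_≡_; _≢_)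
open import Relation.Nullary using (¬_)
open import Function.Definitions using (Surjective)

record Digraph : Set₁ where
  field
    Vtx  : Set
    Edge : Set
    src  : Edge → Vtx
    tgt  : Edge → Vtx

open Digraph public

data Path (G : Digraph) : Vtx G → Vtx G → Set where
  one  : (e : Edge G) → Path G (src G e) (tgt G e)
  cons : (e : Edge G) {w : Vtx G} → Path G (tgt G e) w → Path G (src G e) w

CycleFree : Digraph → Set
CycleFree G = ∀ v → ¬ Path G v v

record FeynmanGraph : Set where
  field
    nV nE nX : ℕ
    srcI tgtI : Fin nE → Fin nV
    attachX  : Fin nX → Fin nV
    typeI    : Fin nE → ℕ
    typeX    : Fin nX → ℕ
    typeI-pos : ∀ e → NonZero (typeI e)
    typeX-pos : ∀ x → NonZero (typeX x)

open FeynmanGraph public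

underlying : FeynmanGraph → Digraph
underlying Γ = record { Vtx = Fin (nV Γ) ; Edge = Fin (nE Γ) ; src = srcI Γ ; tgt = tgtI Γ }

Lt : (Γ : FeynmanGraph) → Fin (nV Γ) → Fin (nV Γ) → Set
Lt Γ v w = Path (underlying Γ) v w

-- A partition of V(Γ) into n blocks P₁,…,Pₙ, given by a block map
-- blk : V(Γ) → Fin n (P_j = blk⁻¹(j)); it is surjective so every block is nonempty.
data WalkIn (Γ : FeynmanGraph) {n : ℕ} (blk : Fin (nV Γ) → Fin n) (j : Fin n)
     : Fin (nV Γ) → Fin (nV Γ) → Set where
  here : ∀ {v} → WalkIn Γ blk j v v
  fwd  : (e : Fin (nE Γ)) {w : Fin (nV Γ)} →
         blk (srcI Γ e) ≡ j → blk (tgtI Γ e) ≡ j →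
         WalkIn Γ blk j (tgtI Γ e) w → WalkIn Γ blk j (srcI Γ e) w
  bwd  : (e : Fin (nE Γ)) {w : Fin (nV Γ)} →
         blk (srcI Γ e) ≡ j → blk (tgtI Γ e) ≡ j →
         WalkIn Γ blk j (srcI Γ e) w → WalkIn Γ blk j (tgtI Γ e) w

BlockConnected : (Γ : FeynmanGraph) {n : ℕ} → (Fin (nV Γ) → Fin n) → Fin n → Set
BlockConnected Γ blk j =
  ∀ v w → blk v ≡ j → blk w ≡ j → WalkIn Γ blk j v w

record CoveringSubgraph (Γ : FeynmanGraph) (n : ℕ) : Set where
  field
    blk       : Fin (nV Γ) → Fin n
    blk-surj  : ∀ j → ∃ λ v → blk v ≡ j
    connected : ∀ j → BlockConnected Γ blk j

open CoveringSubgraph public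

-- contracted graph Γ/γ (internal edges only; external edges are irrelevant
-- to cycles): vertices are blocks, internal edges are the internal edges of Γ
-- joining different blocks, with induced orientation
contract : (Γ : FeynmanGraph) {n : ℕ} → CoveringSubgraph Γ n → Digraph
contract Γ {n} γ = record
  { Vtx  = Fin n
  ; Edge = Σ (Fin (nE Γ)) (λ e → blk γ (srcI Γ e) ≢ blk γ (tgtI Γ e))
  ; src  = λ { (e , _) → blk γ (srcI Γ e) }
  ; tgt  = λ { (e , _) → blk γ (tgtI Γ e) }
  }

Convex : (Γ : FeynmanGraph) → (Fin (nV Γ) → Set) → Set
Convex Γ P = ∀ v u w → P v → P w →
  Lt Γ v u → Lt Γ u w → P u

-- Contracting γ sends a directed path of Γ either into a single block or to a
-- directed path of Γ/γ between the blocks of its ends. If some u with v < u < w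
-- lay outside the block P_j of v and w, the paths v → u and u → w would thus
-- give paths P_j → P_u → P_j in Γ/γ, i.e. a cycle.
module Submission where

open import Defs
open import Data.Nat using (ℕ)
open import Data.Fin using (Fin; _≟_)
open import Data.Sum using (_⊎_; inj₁; inj₂)
open import Data.Product using (_,_)
open import Function using (_∘_)
open import Relation.Nullary using (yes; no; contradiction)
open import Relation.Binary.PropositionalEquality using (_≡_; _≢_; refl; sym)

Path-++ : ∀ {G : Digraph} {a b c} → Path G a b → Path G b c → Path G a c
Path-++ (one e)    q = cons e q
Path-++ (cons e p) q = cons e (Path-++ p q)

ReflPath : (G : Digraph) → Vtx G → Vtx G → Set
ReflPath G a b = a ≡ b ⊎ Path G a b

ReflPath-trans : ∀ {G : Digraph} {a b c} → ReflPath G a b → ReflPath G b c → ReflPath G a c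
ReflPath-trans (inj₁ refl) q           = q
ReflPath-trans (inj₂ p)    (inj₁ refl) = inj₂ p
ReflPath-trans (inj₂ p)    (inj₂ q)    = inj₂ (Path-++ p q)

module _ (Γ : FeynmanGraph) {n : ℕ} (γ : CoveringSubgraph Γ n) where

  edge-contract : (e : Fin (nE Γ)) →
    ReflPath (contract Γ γ) (blk γ (srcI Γ e)) (blk γ (tgtI Γ e))
  edge-contract e with blk γ (srcI Γ e) ≟ blk γ (tgtI Γ e)
  ... | yes same = inj₁ same
  ... | no  diff = inj₂ (one {G = contract Γ γ} (e , diff))

  path-contract : ∀ {a b} → Path (underlying Γ) a b →
    ReflPath (contract Γ γ) (blk γ a) (blk γ b)
  path-contract (one e)    = edge-contract e
  path-contract (cons e p) = ReflPath-trans (edge-contract e) (path-contract p)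

  path-contract-between-blocks : ∀ {a b i k} → Path (underlying Γ) a b →
    blk γ a ≡ i → blk γ b ≡ k → i ≢ k → Path (contract Γ γ) i k
  path-contract-between-blocks p refl refl i≢k with path-contract p
  ... | inj₁ same = contradiction same i≢k
  ... | inj₂ p′   = p′

proposition2p1 : (Γ : FeynmanGraph) → CycleFree (underlying Γ) →
    (n : ℕ) (γ : CoveringSubgraph Γ n) → CycleFree (contract Γ γ) →
    (j : Fin n) → Convex Γ (λ v → blk γ v ≡ j)
proposition2p1 Γ _ n γ contraction-acyclic j v u w v∈Pj w∈Pj v<u u<w with blk γ u ≟ j
... | yes u∈Pj = u∈Pj
... | no  u∉Pj = contradiction
  (Path-++ (path-contract-between-blocks Γ γ v<u v∈Pj refl (u∉Pj ∘ sym))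
           (path-contract-between-blocks Γ γ u<w refl w∈Pj u∉Pj))
  (contraction-acyclic j)
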